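{- Let $k\ge1$ and $\sigma>k^2-k$. Then a $(k,\sigma)$-PdB-string can exist only if $k$ divides $\binom{\sigma+k-1}{k-1}$. In particular, if $\sigma>k^2-k$ and $k$ is prime, then a $(k,\sigma)$-PdB-string can exist only if $k$ does not divide $\sigma$.
   Context: Let $\Sigma=\{a_1<\dots<a_\sigma\}$. For a string $u$, $\mathbf{pv}(u)\in\mathbb{N}^\sigma$ has $i$-th entry the number of occurrences of $a_i$ in $u$; the order of a Parikh vector is the sum of its entries. A string $w$ over $\Sigma$ is a $(k,\sigma)$-PdB-string if for every Parikh vector $p\in\mathbb{N}^\sigma$ of order $k$ there is exactly one (occurrence of a) length-$k$ substring $u$ of $w$ with $\mathbf{pv}(u)=p$. -}

module Defs where

open import Data.Nat using (ℕ; zero; suc; _+_; _<?_)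
open import Data.Fin using (Fin)
open import Data.Fin.Properties using () renaming (_≟_ to _≟ᶠ_)
open import Data.List as List using (List; []; _∷_; length; take)
open import Data.Vec as Vec using (Vec; tabulate)
open import Relation.Nullary using (yes; no)
open import Relation.Binary.PropositionalEquality using (_≡_)

-- Strings over the ordered alphabet Σ = {a_1 < … < a_σ}, represented as Fin σ
-- (letter a_{i+1} is the element i : Fin σ).
Str : ℕ → Set
Str σ = List (Fin σ)

occ : ∀ {σ} → Fin σ → Str σ → ℕ
occ a [] = 0
occ a (x ∷ u) with a ≟ᶠ x
... | yes _ = suc (occ a u)
... | no  _ = occ a u

pv : ∀ {σ} → Str σ → Vec ℕ σ
pv u = tabulate (λ i → occ i u)

order : ∀ {σ} → Vec ℕ σ → ℕ
order = Vec.sum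

windows : ∀ {σ} → ℕ → Str σ → List (Str σ)
windows zero [] = [] ∷ []
windows (suc _) [] = []
windows k (x ∷ w) with length (x ∷ w) <? k
... | yes _ = []
... | no  _ = take k (x ∷ w) ∷ windows k w

countPV : ∀ {σ} → ℕ → Str σ → Vec ℕ σ → ℕ
countPV k w p = List.length (List.filter (λ u → Data.Vec.Properties.≡-dec Data.Nat._≟_ (pv u) p) (windows k w))
  where import Data.Vec.Properties
        import Data.Nat

IsPdB : (k σ : ℕ) → Str σ → Set
IsPdB k σ w = (p : Vec ℕ σ) → order p ≡ k → countPV k w p ≡ 1

-- Let k = 1 + m and σ > m(m + 1) ≥ 2m. Some letter a occurs neither among the first m nor
-- among the last m letters of w, so every occurrence of a lies in exactly k windows of
-- length k and the windows contain a exactly k · occ a w times in total. On the other hand,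
-- the windows realise every Parikh vector of order k exactly once, so they contain a as often
-- as all Parikh vectors of order k together, namely C(σ + k - 1, k - 1) times.
-- For prime k, C(σ + m, m) · m! = (σ + 1) ⋯ (σ + m), so k divides some σ + i with 1 ≤ i < k,
-- which is impossible when k divides σ.
module Submission where

open import Data.Bool.Base using (true; false; if_then_else_)
open import Data.Fin.Base using (Fin; zero; suc)
open import Data.Fin.Properties using () renaming (_≟_ to _≟ᶠ_)
open import Data.List.Base using (List; []; _∷_; [_]; _++_; map; length; take; drop; filter)
open import Data.List.Properties
  using (length-++; length-map; length-take; length-drop; take-take)
open import Data.List.Relation.Unary.All as All using (All; []; _∷_)
import Data.List.Relation.Unary.All.Properties as All
open import Data.Nat.Base using (ℕ; zero; suc; _+_; _∸_; _*_; _≤_; _<_; _>_; _!; z≤n; s≤s)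
open import Data.Nat.Combinatorics
  using (_C_; nCn≡1; nCk+nC[k+1]≡[n+1]C[k+1]; nCk≡n!/k![n-k]!; k![n∸k]!∣n!)
open import Data.Nat.DivMod using (_/_; m/n*n≡m)
open import Data.Nat.Divisibility using (_∣_; m∣m*n; ∣m⇒∣m*n; ∣m+n∣m⇒∣n; ∣⇒≤; ∣1⇒≡1)
open import Data.Nat.Primality using (Prime; euclidsLemma; ¬prime[0]; ¬prime[1])
open import Data.Nat.Properties
open import Algebra.Properties.CommutativeSemigroup +-commutativeSemigroup using (interchange)
open import Data.Nat.Tactic.RingSolver using (solve-∀)
open import Data.Product.Base using (_×_; _,_; ∃)
open import Data.Sum.Base using (inj₁; inj₂)
open import Data.Vec.Base using (Vec; []; _∷_; lookup; replicate; tabulate; sum)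
open import Data.Vec.Properties using (≡-dec; lookup∘tabulate; tabulate-cong; lookup-replicate)
open import Relation.Binary.Definitions using (DecidableEquality)
open import Relation.Binary.PropositionalEquality
  using (_≡_; refl; sym; trans; cong; cong₂; subst; module ≡-Reasoning)
open import Relation.Nullary using (Dec; yes; no; does; ¬_; contradiction)
open import Relation.Nullary.Decidable using (dec-true)
open import Relation.Unary using (Decidable)

open import Defs

open ≡-Reasoning

private
  variable
    A B : Set
    σ : ℕ

∑ : List A → (A → ℕ) → ℕ
∑ []       f = 0
∑ (x ∷ xs) f = f x + ∑ xs f

infix 6.5 ∑
syntax ∑ xs (λ x → e) = ∑[ x ∈ xs ] e

∑-++ : ∀ xs ys (f : A → ℕ) → ∑ (xs ++ ys) f ≡ ∑ xs f + ∑ ys f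
∑-++ []       ys f = refl
∑-++ (x ∷ xs) ys f = trans (cong (f x +_) (∑-++ xs ys f)) (sym (+-assoc (f x) _ _))

∑-map : ∀ (g : A → B) xs (f : B → ℕ) → ∑ (map g xs) f ≡ ∑[ x ∈ xs ] f (g x)
∑-map g []       f = refl
∑-map g (x ∷ xs) f = cong (f (g x) +_) (∑-map g xs f)

∑-cong : ∀ xs {f g : A → ℕ} → (∀ x → f x ≡ g x) → ∑ xs f ≡ ∑ xs g
∑-cong []       f≗g = refl
∑-cong (x ∷ xs) f≗g = cong₂ _+_ (f≗g x) (∑-cong xs f≗g)

∑-cong-All : ∀ {xs} {f g : A → ℕ} → All (λ x → f x ≡ g x) xs → ∑ xs f ≡ ∑ xs g
∑-cong-All []            = refl
∑-cong-All (fx≡gx ∷ f≗g) = cong₂ _+_ fx≡gx (∑-cong-All f≗g)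

∑-0 : ∀ (xs : List A) → ∑[ x ∈ xs ] 0 ≡ 0
∑-0 []       = refl
∑-0 (x ∷ xs) = ∑-0 xs

∑-+ : ∀ xs (f g : A → ℕ) → ∑[ x ∈ xs ] (f x + g x) ≡ ∑ xs f + ∑ xs g
∑-+ []       f g = refl
∑-+ (x ∷ xs) f g =
  trans (cong (f x + g x +_) (∑-+ xs f g)) (interchange (f x) (g x) (∑ xs f) (∑ xs g))

∑-*ʳ : ∀ xs (f : A → ℕ) c → ∑[ x ∈ xs ] (f x * c) ≡ ∑ xs f * c
∑-*ʳ []       f c = refl
∑-*ʳ (x ∷ xs) f c =
  trans (cong (f x * c +_) (∑-*ʳ xs f c)) (sym (*-distribʳ-+ c (f x) (∑ xs f)))

∑-suc : ∀ xs (f : A → ℕ) → ∑[ x ∈ xs ] suc (f x) ≡ ∑ xs f + length xs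
∑-suc []       f = refl
∑-suc (x ∷ xs) f = begin
  suc (f x + ∑[ y ∈ xs ] suc (f y))  ≡⟨ cong (λ t → suc (f x + t)) (∑-suc xs f) ⟩
  suc (f x + (∑ xs f + length xs))   ≡⟨ cong suc (sym (+-assoc (f x) (∑ xs f) (length xs))) ⟩
  suc (f x + ∑ xs f + length xs)     ≡⟨ sym (+-suc (f x + ∑ xs f) (length xs)) ⟩
  f x + ∑ xs f + suc (length xs)     ∎

∑-comm : ∀ xs ys (g : A → B → ℕ) →
         ∑[ x ∈ xs ] ∑[ y ∈ ys ] g x y ≡ ∑[ y ∈ ys ] ∑[ x ∈ xs ] g x y
∑-comm []       ys g = sym (∑-0 ys)
∑-comm (x ∷ xs) ys g = begin
  ∑[ y ∈ ys ] g x y + ∑[ x′ ∈ xs ] ∑[ y ∈ ys ] g x′ y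
    ≡⟨ cong (∑[ y ∈ ys ] g x y +_) (∑-comm xs ys g) ⟩
  ∑[ y ∈ ys ] g x y + ∑[ y ∈ ys ] ∑[ x′ ∈ xs ] g x′ y
    ≡⟨ sym (∑-+ ys (g x) (λ y → ∑[ x′ ∈ xs ] g x′ y)) ⟩
  ∑[ y ∈ ys ] (g x y + ∑[ x′ ∈ xs ] g x′ y)
    ∎

𝟙 : {P : Set} → Dec P → ℕ
𝟙 P? = if does P? then 1 else 0

𝟙-yes : {P : Set} (P? : Dec P) → P → 𝟙 P? ≡ 1
𝟙-yes P? p = cong (if_then 1 else 0) (dec-true P? p)

length-filter : ∀ {P : A → Set} (P? : Decidable P) xs →
                length (filter P? xs) ≡ ∑[ x ∈ xs ] 𝟙 (P? x)
length-filter P? []       = refl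
length-filter P? (x ∷ xs) with does (P? x)
... | true  = cong suc (length-filter P? xs)
... | false = length-filter P? xs

module _ (_≟_ : DecidableEquality B) where

  𝟙≟-* : ∀ (f : B → ℕ) x y → 𝟙 (x ≟ y) * f y ≡ 𝟙 (x ≟ y) * f x
  𝟙≟-* f x y with x ≟ y
  ... | yes refl = refl
  ... | no _     = refl

  ∑-fibres : ∀ (g : A → B) (f : B → ℕ) xs ys →
             All (λ x → ∑[ y ∈ ys ] 𝟙 (g x ≟ y) ≡ 1) xs →
             ∑[ x ∈ xs ] f (g x) ≡ ∑[ y ∈ ys ] (∑[ x ∈ xs ] 𝟙 (g x ≟ y)) * f y
  ∑-fibres g f xs ys listedOnce = begin
    ∑[ x ∈ xs ] f (g x)
      ≡⟨ ∑-cong-All (All.map (λ {x} → spread x) listedOnce) ⟩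
    ∑[ x ∈ xs ] ∑[ y ∈ ys ] 𝟙 (g x ≟ y) * f y
      ≡⟨ ∑-comm xs ys (λ x y → 𝟙 (g x ≟ y) * f y) ⟩
    ∑[ y ∈ ys ] ∑[ x ∈ xs ] 𝟙 (g x ≟ y) * f y
      ≡⟨ ∑-cong ys (λ y → ∑-*ʳ xs (λ x → 𝟙 (g x ≟ y)) (f y)) ⟩
    ∑[ y ∈ ys ] (∑[ x ∈ xs ] 𝟙 (g x ≟ y)) * f y
      ∎
    where
    spread : ∀ x → ∑[ y ∈ ys ] 𝟙 (g x ≟ y) ≡ 1 → f (g x) ≡ ∑[ y ∈ ys ] 𝟙 (g x ≟ y) * f y
    spread x once = begin
      f (g x)                                    ≡⟨ sym (*-identityˡ (f (g x))) ⟩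
      1 * f (g x)                                ≡⟨ cong (_* f (g x)) (sym once) ⟩
      (∑[ y ∈ ys ] 𝟙 (g x ≟ y)) * f (g x)        ≡⟨ sym (∑-*ʳ ys (λ y → 𝟙 (g x ≟ y)) (f (g x))) ⟩
      ∑[ y ∈ ys ] 𝟙 (g x ≟ y) * f (g x)          ≡⟨ ∑-cong ys (λ y → sym (𝟙≟-* f (g x) y)) ⟩
      ∑[ y ∈ ys ] 𝟙 (g x ≟ y) * f y              ∎

infix 4 _≟ᵥ_
_≟ᵥ_ : DecidableEquality (Vec ℕ σ)
_≟ᵥ_ = ≡-dec _≟_

sucHead : Vec ℕ (suc σ) → Vec ℕ (suc σ)
sucHead (x ∷ p) = suc x ∷ p

parikhVectors : (σ k : ℕ) → List (Vec ℕ σ)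
parikhVectors σ       zero    = [ replicate σ 0 ]
parikhVectors zero    (suc k) = []
parikhVectors (suc σ) (suc k) =
  map sucHead (parikhVectors (suc σ) k) ++ map (0 ∷_) (parikhVectors σ (suc k))

∑-parikhVectors-suc : ∀ σ k (f : Vec ℕ (suc σ) → ℕ) →
  ∑[ p ∈ parikhVectors (suc σ) (suc k) ] f p
    ≡ ∑[ p ∈ parikhVectors (suc σ) k ] f (sucHead p)
      + ∑[ p ∈ parikhVectors σ (suc k) ] f (0 ∷ p)
∑-parikhVectors-suc σ k f =
  trans (∑-++ (map sucHead (parikhVectors (suc σ) k)) _ f)
        (cong₂ _+_ (∑-map sucHead (parikhVectors (suc σ) k) f)
                   (∑-map (0 ∷_) (parikhVectors σ (suc k)) f))

length-parikhVectors-suc : ∀ σ k →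
  length (parikhVectors (suc σ) (suc k))
    ≡ length (parikhVectors (suc σ) k) + length (parikhVectors σ (suc k))
length-parikhVectors-suc σ k =
  trans (length-++ (map sucHead (parikhVectors (suc σ) k)))
        (cong₂ _+_ (length-map sucHead (parikhVectors (suc σ) k))
                   (length-map (0 ∷_) (parikhVectors σ (suc k))))

order-replicate-0 : ∀ σ → order (replicate σ 0) ≡ 0
order-replicate-0 zero    = refl
order-replicate-0 (suc σ) = order-replicate-0 σ

order≡0⇒replicate-0 : (p : Vec ℕ σ) → order p ≡ 0 → p ≡ replicate σ 0
order≡0⇒replicate-0 []         _       = refl
order≡0⇒replicate-0 (zero ∷ p) order≡0 = cong (0 ∷_) (order≡0⇒replicate-0 p order≡0)

parikhVectors-order : ∀ σ k → All (λ p → order p ≡ k) (parikhVectors σ k)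
parikhVectors-order σ       zero    = order-replicate-0 σ ∷ []
parikhVectors-order zero    (suc k) = []
parikhVectors-order (suc σ) (suc k) =
  All.++⁺ (All.map⁺ (All.map (λ {p} → order-sucHead p) (parikhVectors-order (suc σ) k)))
          (All.map⁺ (parikhVectors-order σ (suc k)))
  where
  order-sucHead : ∀ (p : Vec ℕ (suc σ)) {k} → order p ≡ k → order (sucHead p) ≡ suc k
  order-sucHead (x ∷ p) = cong suc

∑-𝟙-parikhVectors : ∀ σ k (p : Vec ℕ σ) → order p ≡ k →
                    ∑[ q ∈ parikhVectors σ k ] 𝟙 (p ≟ᵥ q) ≡ 1
∑-𝟙-parikhVectors σ zero p order≡0 =
  cong (_+ 0) (𝟙-yes (p ≟ᵥ replicate σ 0) (order≡0⇒replicate-0 p order≡0))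
∑-𝟙-parikhVectors zero (suc k) [] ()
∑-𝟙-parikhVectors (suc σ) (suc k) (zero ∷ p) order≡k =
  trans (∑-parikhVectors-suc σ k (λ q → 𝟙 (0 ∷ p ≟ᵥ q)))
        (cong₂ _+_ (trans (∑-cong (parikhVectors (suc σ) k) λ { (y ∷ q) → refl })
                          (∑-0 (parikhVectors (suc σ) k)))
                   (∑-𝟙-parikhVectors σ (suc k) p order≡k))
∑-𝟙-parikhVectors (suc σ) (suc k) (suc x ∷ p) order≡k =
  trans (∑-parikhVectors-suc σ k (λ q → 𝟙 (suc x ∷ p ≟ᵥ q)))
        (cong₂ _+_ (trans (∑-cong (parikhVectors (suc σ) k) λ { (y ∷ q) → refl })
                          (∑-𝟙-parikhVectors (suc σ) k (x ∷ p) (suc-injective order≡k)))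
                   (∑-0 (parikhVectors σ (suc k))))

∑-lookup-parikhVectors : ∀ σ k (a : Fin σ) →
  ∑[ p ∈ parikhVectors σ (suc k) ] lookup p a ≡ length (parikhVectors (suc σ) k)
∑-lookup-parikhVectors (suc σ) k a =
  trans (∑-parikhVectors-suc σ k (λ p → lookup p a)) (split k a)
  where
  V : (σ k : ℕ) → List (Vec ℕ σ)
  V = parikhVectors
  split : ∀ k (a : Fin (suc σ)) →
          ∑[ p ∈ V (suc σ) k ] lookup (sucHead p) a + ∑[ p ∈ V σ (suc k) ] lookup (0 ∷ p) a
            ≡ length (V (suc (suc σ)) k)
  split zero    zero    = cong suc (∑-0 (V σ 1))
  split zero    (suc a) =
    cong₂ _+_ (cong (_+ 0) (lookup-replicate a 0)) (∑-lookup-parikhVectors σ zero a)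
  split (suc k) zero    = begin
    ∑[ p ∈ V (suc σ) (suc k) ] lookup (sucHead p) zero + ∑[ p ∈ V σ (suc (suc k)) ] 0
      ≡⟨ cong₂ _+_ (∑-cong (V (suc σ) (suc k)) λ { (x ∷ p) → refl })
                   (∑-0 (V σ (suc (suc k)))) ⟩
    ∑[ p ∈ V (suc σ) (suc k) ] suc (lookup p zero) + 0
      ≡⟨ +-identityʳ _ ⟩
    ∑[ p ∈ V (suc σ) (suc k) ] suc (lookup p zero)
      ≡⟨ ∑-suc (V (suc σ) (suc k)) (λ p → lookup p zero) ⟩
    ∑[ p ∈ V (suc σ) (suc k) ] lookup p zero + length (V (suc σ) (suc k))
      ≡⟨ cong (_+ length (V (suc σ) (suc k))) (∑-lookup-parikhVectors (suc σ) k zero) ⟩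
    length (V (suc (suc σ)) k) + length (V (suc σ) (suc k))
      ≡⟨ sym (length-parikhVectors-suc (suc σ) k) ⟩
    length (V (suc (suc σ)) (suc k))
      ∎
  split (suc k) (suc a) = begin
    ∑[ p ∈ V (suc σ) (suc k) ] lookup (sucHead p) (suc a)
      + ∑[ p ∈ V σ (suc (suc k)) ] lookup p a
      ≡⟨ cong₂ _+_ (trans (∑-cong (V (suc σ) (suc k)) λ { (x ∷ p) → refl })
                          (∑-lookup-parikhVectors (suc σ) k (suc a)))
                   (∑-lookup-parikhVectors σ (suc k) a) ⟩
    length (V (suc (suc σ)) k) + length (V (suc σ) (suc k))
      ≡⟨ sym (length-parikhVectors-suc (suc σ) k) ⟩
    length (V (suc (suc σ)) (suc k))
      ∎

length-parikhVectors : ∀ σ k → length (parikhVectors (suc σ) k) ≡ (σ + k) C k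
length-parikhVectors σ       zero    = refl
length-parikhVectors zero    (suc k) = begin
  length (parikhVectors 1 (suc k))         ≡⟨ length-parikhVectors-suc zero k ⟩
  length (parikhVectors 1 k) + 0           ≡⟨ cong (_+ 0) (length-parikhVectors zero k) ⟩
  k C k + 0                                ≡⟨ cong (_+ 0) (nCn≡1 k) ⟩
  1                                        ≡⟨ sym (nCn≡1 (suc k)) ⟩
  suc k C suc k                            ∎
length-parikhVectors (suc σ) (suc k) = begin
  length (parikhVectors (suc (suc σ)) (suc k))
    ≡⟨ length-parikhVectors-suc (suc σ) k ⟩
  length (parikhVectors (suc (suc σ)) k) + length (parikhVectors (suc σ) (suc k))
    ≡⟨ cong₂ _+_ (length-parikhVectors (suc σ) k) (length-parikhVectors σ (suc k)) ⟩
  (suc σ + k) C k + (σ + suc k) C suc k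
    ≡⟨ cong (λ n → n C k + (σ + suc k) C suc k) (sym (+-suc σ k)) ⟩
  (σ + suc k) C k + (σ + suc k) C suc k
    ≡⟨ nCk+nC[k+1]≡[n+1]C[k+1] (σ + suc k) k ⟩
  (suc σ + suc k) C suc k
    ∎

occ-∷ : (a x : Fin σ) (u : Str σ) → occ a (x ∷ u) ≡ 𝟙 (a ≟ᶠ x) + occ a u
occ-∷ a x u with a ≟ᶠ x
... | yes _ = refl
... | no  _ = refl

occ-++ : (a : Fin σ) (u v : Str σ) → occ a (u ++ v) ≡ occ a u + occ a v
occ-++ a []      v = refl
occ-++ a (x ∷ u) v = begin
  occ a (x ∷ u ++ v)                  ≡⟨ occ-∷ a x (u ++ v) ⟩
  𝟙 (a ≟ᶠ x) + occ a (u ++ v)         ≡⟨ cong (𝟙 (a ≟ᶠ x) +_) (occ-++ a u v) ⟩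
  𝟙 (a ≟ᶠ x) + (occ a u + occ a v)    ≡⟨ sym (+-assoc (𝟙 (a ≟ᶠ x)) _ _) ⟩
  𝟙 (a ≟ᶠ x) + occ a u + occ a v      ≡⟨ cong (_+ occ a v) (sym (occ-∷ a x u)) ⟩
  occ a (x ∷ u) + occ a v             ∎

occ-take-≤ : (a : Fin σ) (n : ℕ) (u : Str σ) → occ a (take n u) ≤ occ a u
occ-take-≤ a zero    u       = z≤n
occ-take-≤ a (suc n) []      = z≤n
occ-take-≤ a (suc n) (x ∷ u) rewrite occ-∷ a x (take n u) | occ-∷ a x u =
  +-monoʳ-≤ (𝟙 (a ≟ᶠ x)) (occ-take-≤ a n u)

sum-tabulate-0 : ∀ n → sum (tabulate {n = n} (λ _ → 0)) ≡ 0
sum-tabulate-0 zero    = refl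
sum-tabulate-0 (suc n) = sum-tabulate-0 n

sum-tabulate-+ : ∀ {n} (f g : Fin n → ℕ) →
                 sum (tabulate (λ i → f i + g i)) ≡ sum (tabulate f) + sum (tabulate g)
sum-tabulate-+ {zero}  f g = refl
sum-tabulate-+ {suc n} f g =
  trans (cong (f zero + g zero +_) (sum-tabulate-+ (λ i → f (suc i)) (λ i → g (suc i))))
        (interchange (f zero) (g zero) _ _)

sum-tabulate-𝟙≟ : ∀ {n} (x : Fin n) → sum (tabulate (λ i → 𝟙 (i ≟ᶠ x))) ≡ 1
sum-tabulate-𝟙≟ {suc n} zero    = cong suc (sum-tabulate-0 n)
sum-tabulate-𝟙≟ {suc n} (suc x) = sum-tabulate-𝟙≟ x

order-pv : (u : Str σ) → order (pv u) ≡ length u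
order-pv {σ} []  = sum-tabulate-0 σ
order-pv (x ∷ u) = begin
  sum (tabulate (λ i → occ i (x ∷ u)))
    ≡⟨ cong sum (tabulate-cong (λ i → occ-∷ i x u)) ⟩
  sum (tabulate (λ i → 𝟙 (i ≟ᶠ x) + occ i u))
    ≡⟨ sum-tabulate-+ (λ i → 𝟙 (i ≟ᶠ x)) (λ i → occ i u) ⟩
  sum (tabulate (λ i → 𝟙 (i ≟ᶠ x))) + order (pv u)
    ≡⟨ cong₂ _+_ (sum-tabulate-𝟙≟ x) (order-pv u) ⟩
  suc (length u)
    ∎

∃-zero-entry : (p : Vec ℕ σ) → order p < σ → ∃ λ i → lookup p i ≡ 0
∃-zero-entry (zero  ∷ p) _             = zero , refl
∃-zero-entry (suc x ∷ p) (s≤s order<σ)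
  with ∃-zero-entry p (≤-trans (s≤s (m≤n+m _ x)) order<σ)
... | i , pᵢ≡0 = suc i , pᵢ≡0

∃-absent-letter : (u : Str σ) → length u < σ → ∃ λ a → occ a u ≡ 0
∃-absent-letter u |u|<σ with ∃-zero-entry (pv u) (subst (_< _) (sym (order-pv u)) |u|<σ)
... | a , pvₐ≡0 = a , trans (sym (lookup∘tabulate (λ i → occ i u) a)) pvₐ≡0

windows-length : ∀ k (w : Str σ) → All (λ u → length u ≡ k) (windows k w)
windows-length zero    []      = refl ∷ []
windows-length (suc k) []      = []
windows-length zero    (x ∷ w) = refl ∷ windows-length zero w
windows-length (suc k) (x ∷ w) with length (x ∷ w) <? suc k
... | yes _     = []
... | no  |w|≮k =
  trans (length-take (suc k) (x ∷ w)) (m≤n⇒m⊓n≡m (≮⇒≥ |w|≮k)) ∷ windows-length (suc k) w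

module _ (a : Fin σ) where

  occPrefixes : ℕ → Str σ → ℕ
  occPrefixes zero    v = 0
  occPrefixes (suc n) v = occ a (take n v) + occPrefixes n v

  occPrefixes-∷ : ∀ n x v → occPrefixes (suc n) (x ∷ v) ≡ n * 𝟙 (a ≟ᶠ x) + occPrefixes n v
  occPrefixes-∷ zero    x v = refl
  occPrefixes-∷ (suc n) x v = begin
    occ a (x ∷ take n v) + occPrefixes (suc n) (x ∷ v)
      ≡⟨ cong₂ _+_ (occ-∷ a x (take n v)) (occPrefixes-∷ n x v) ⟩
    𝟙 (a ≟ᶠ x) + occ a (take n v) + (n * 𝟙 (a ≟ᶠ x) + occPrefixes n v)
      ≡⟨ interchange (𝟙 (a ≟ᶠ x)) _ _ _ ⟩
    suc n * 𝟙 (a ≟ᶠ x) + occPrefixes (suc n) v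
      ∎

  occPrefixes-absent : ∀ n v → occ a (take n v) ≡ 0 → occPrefixes (suc n) v ≡ 0
  occPrefixes-absent zero    v _          = refl
  occPrefixes-absent (suc n) v a∉take1+n =
    cong₂ _+_ a∉take1+n (occPrefixes-absent n v (n≤0⇒n≡0 occ-take-n≤0))
    where
    occ-take-n≤0 : occ a (take n v) ≤ 0
    occ-take-n≤0 = subst (λ u → occ a u ≤ 0) take-n-of-take-1+n
                         (≤-trans (occ-take-≤ a n (take (suc n) v)) (≤-reflexive a∉take1+n))
      where
      take-n-of-take-1+n : take n (take (suc n) v) ≡ take n v
      take-n-of-take-1+n =
        trans (take-take n (suc n) v) (cong (λ i → take i v) (m≤n⇒m⊓n≡m (n≤1+n n)))

  occPrefixes-absent-everywhere : ∀ m v → occ a v ≡ 0 → occPrefixes (suc m) v ≡ suc m * occ a v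
  occPrefixes-absent-everywhere m v a∉v = begin
    occPrefixes (suc m) v
      ≡⟨ occPrefixes-absent m v (n≤0⇒n≡0 (≤-trans (occ-take-≤ a m v) (≤-reflexive a∉v))) ⟩
    0                      ≡⟨ sym (*-zeroʳ (suc m)) ⟩
    suc m * 0              ≡⟨ cong (suc m *_) (sym a∉v) ⟩
    suc m * occ a v        ∎

  -- An occurrence of a at position i < m lies in only i + 1 of the windows;
  -- occPrefixes (suc m) v counts it the missing m - i times.
  ∑-occ-windows+occPrefixes : ∀ m v → occ a (drop (length v ∸ m) v) ≡ 0 →
    ∑[ u ∈ windows (suc m) v ] occ a u + occPrefixes (suc m) v ≡ suc m * occ a v
  ∑-occ-windows+occPrefixes m []      _ = occPrefixes-absent-everywhere m [] refl
  ∑-occ-windows+occPrefixes m (x ∷ v) a∉suffix with length (x ∷ v) <? suc m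
  ... | yes |x∷v|<1+m = occPrefixes-absent-everywhere m (x ∷ v)
          (subst (λ i → occ a (drop i (x ∷ v)) ≡ 0) (m≤n⇒m∸n≡0 (≤-pred |x∷v|<1+m)) a∉suffix)
  ... | no  |x∷v|≮1+m = begin
    occ a (x ∷ take m v) + ∑[ u ∈ windows (suc m) v ] occ a u + occPrefixes (suc m) (x ∷ v)
      ≡⟨ cong₂ _+_ (cong (_+ _) (occ-∷ a x (take m v))) (occPrefixes-∷ m x v) ⟩
    d + occ a (take m v) + ∑[ u ∈ windows (suc m) v ] occ a u + (m * d + occPrefixes m v)
      ≡⟨ rearrange d _ _ _ m ⟩
    suc m * d + (∑[ u ∈ windows (suc m) v ] occ a u + occPrefixes (suc m) v)
      ≡⟨ cong (suc m * d +_) (∑-occ-windows+occPrefixes m v a∉suffixᵥ) ⟩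
    suc m * d + suc m * occ a v
      ≡⟨ sym (*-distribˡ-+ (suc m) d (occ a v)) ⟩
    suc m * (d + occ a v)
      ≡⟨ cong (suc m *_) (sym (occ-∷ a x v)) ⟩
    suc m * occ a (x ∷ v)
      ∎
    where
    d = 𝟙 (a ≟ᶠ x)
    rearrange : ∀ d t s q m → d + t + s + (m * d + q) ≡ suc m * d + (s + (t + q))
    rearrange = solve-∀
    a∉suffixᵥ : occ a (drop (length v ∸ m) v) ≡ 0
    a∉suffixᵥ = subst (λ i → occ a (drop i (x ∷ v)) ≡ 0)
                      (+-∸-assoc 1 (≤-pred (≮⇒≥ |x∷v|≮1+m))) a∉suffix

  ∑-occ-windows : ∀ m w → occ a (take m w) ≡ 0 → occ a (drop (length w ∸ m) w) ≡ 0 →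
                  ∑[ u ∈ windows (suc m) w ] occ a u ≡ suc m * occ a w
  ∑-occ-windows m w a∉prefix a∉suffix = begin
    ∑[ u ∈ windows (suc m) w ] occ a u
      ≡⟨ sym (+-identityʳ _) ⟩
    ∑[ u ∈ windows (suc m) w ] occ a u + 0
      ≡⟨ cong (∑[ u ∈ windows (suc m) w ] occ a u +_)
              (sym (occPrefixes-absent m w a∉prefix)) ⟩
    ∑[ u ∈ windows (suc m) w ] occ a u + occPrefixes (suc m) w
      ≡⟨ ∑-occ-windows+occPrefixes m w a∉suffix ⟩
    suc m * occ a w
      ∎

∑-windows≡∑-parikhVectors : ∀ {k} {w : Str σ} → IsPdB k σ w → (f : Vec ℕ σ → ℕ) →
  ∑[ u ∈ windows k w ] f (pv u) ≡ ∑[ p ∈ parikhVectors σ k ] f p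
∑-windows≡∑-parikhVectors {σ} {k} {w} pdb f = begin
  ∑[ u ∈ windows k w ] f (pv u)
    ≡⟨ ∑-fibres _≟ᵥ_ pv f (windows k w) (parikhVectors σ k)
                (All.map (λ {u} → pv-listedOnce {u}) (windows-length k w)) ⟩
  ∑[ p ∈ parikhVectors σ k ] (∑[ u ∈ windows k w ] 𝟙 (pv u ≟ᵥ p)) * f p
    ≡⟨ ∑-cong-All (All.map realisedOnce (parikhVectors-order σ k)) ⟩
  ∑[ p ∈ parikhVectors σ k ] f p
    ∎
  where
  pv-listedOnce : ∀ {u : Str σ} → length u ≡ k →
                  ∑[ p ∈ parikhVectors σ k ] 𝟙 (pv u ≟ᵥ p) ≡ 1
  pv-listedOnce {u} |u|≡k = ∑-𝟙-parikhVectors σ k (pv u) (trans (order-pv u) |u|≡k)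

  realisedOnce : ∀ {p} → order p ≡ k → (∑[ u ∈ windows k w ] 𝟙 (pv u ≟ᵥ p)) * f p ≡ f p
  realisedOnce {p} order≡k = begin
    (∑[ u ∈ windows k w ] 𝟙 (pv u ≟ᵥ p)) * f p
      ≡⟨ cong (_* f p) (sym (length-filter (λ u → pv u ≟ᵥ p) (windows k w))) ⟩
    countPV k w p * f p
      ≡⟨ cong (_* f p) (pdb p order≡k) ⟩
    1 * f p
      ≡⟨ *-identityˡ (f p) ⟩
    f p
      ∎

n∸[n∸m]≤m : ∀ n m → n ∸ (n ∸ m) ≤ m
n∸[n∸m]≤m n m with ≤-total m n
... | inj₁ m≤n = ≤-reflexive (m∸[m∸n]≡n m≤n)
... | inj₂ n≤m = subst (λ i → n ∸ i ≤ m) (sym (m≤n⇒m∸n≡0 n≤m)) n≤m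

length-take++drop≤ : ∀ m (w : List A) → length (take m w ++ drop (length w ∸ m) w) ≤ m + m
length-take++drop≤ m w =
  subst (_≤ m + m) (sym (length-++ (take m w)))
        (+-mono-≤ (subst (_≤ m) (sym (length-take m w)) (m⊓n≤m m (length w)))
                  (subst (_≤ m) (sym (length-drop (length w ∸ m) w))
                         (n∸[n∸m]≤m (length w) m)))

m+m≤[1+m]*[1+m]∸[1+m] : ∀ m → m + m ≤ suc m * suc m ∸ suc m
m+m≤[1+m]*[1+m]∸[1+m] zero      = z≤n
m+m≤[1+m]*[1+m]∸[1+m] m@(suc _) =
  ≤-trans (+-monoʳ-≤ m (m≤m*n m m))
          (≤-reflexive (trans (sym (*-suc m m)) (sym (m+n∸m≡n (suc m) (m * suc m)))))

pdb⇒∣binomial : ∀ m (w : Str σ) → IsPdB (suc m) σ w → m + m < σ → suc m ∣ (σ + m) C m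
pdb⇒∣binomial {σ} m w pdb 2m<σ
  with ∃-absent-letter (take m w ++ drop (length w ∸ m) w)
                       (≤-<-trans (length-take++drop≤ m w) 2m<σ)
... | a , a∉border = subst (suc m ∣_) count (m∣m*n (occ a w))
  where
  a∉prefix+a∉suffix : occ a (take m w) + occ a (drop (length w ∸ m) w) ≡ 0
  a∉prefix+a∉suffix = trans (sym (occ-++ a (take m w) _)) a∉border

  count : suc m * occ a w ≡ (σ + m) C m
  count = begin
    suc m * occ a w
      ≡⟨ sym (∑-occ-windows a m w (m+n≡0⇒m≡0 _ a∉prefix+a∉suffix)
                                  (m+n≡0⇒n≡0 _ a∉prefix+a∉suffix)) ⟩
    ∑[ u ∈ windows (suc m) w ] occ a u
      ≡⟨ ∑-cong (windows (suc m) w) (λ u → sym (lookup∘tabulate (λ i → occ i u) a)) ⟩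
    ∑[ u ∈ windows (suc m) w ] lookup (pv u) a
      ≡⟨ ∑-windows≡∑-parikhVectors {k = suc m} {w = w} pdb (λ p → lookup p a) ⟩
    ∑[ p ∈ parikhVectors σ (suc m) ] lookup p a
      ≡⟨ ∑-lookup-parikhVectors σ m a ⟩
    length (parikhVectors (suc σ) m)
      ≡⟨ length-parikhVectors σ m ⟩
    (σ + m) C m
      ∎

rising : ℕ → ℕ → ℕ
rising s zero    = 1
rising s (suc j) = suc (j + s) * rising s j

[j+s]!≡rising*s! : ∀ s j → (j + s) ! ≡ rising s j * s !
[j+s]!≡rising*s! s zero    = sym (*-identityˡ (s !))
[j+s]!≡rising*s! s (suc j) =
  trans (cong (suc (j + s) *_) ([j+s]!≡rising*s! s j))
        (sym (*-assoc (suc (j + s)) (rising s j) (s !)))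

binomial*factorials : ∀ s j → ((j + s) C j) * (j ! * s !) ≡ (j + s) !
binomial*factorials s j = begin
  ((j + s) C j) * (j ! * s !)
    ≡⟨ cong (λ t → ((j + s) C j) * (j ! * t !)) (sym (m+n∸m≡n j s)) ⟩
  ((j + s) C j) * (j ! * (j + s ∸ j) !)
    ≡⟨ cong (_* (j ! * (j + s ∸ j) !)) (nCk≡n!/k![n-k]! (m≤m+n j s)) ⟩
  (j + s) ! / (j ! * (j + s ∸ j) !) * (j ! * (j + s ∸ j) !)
    ≡⟨ m/n*n≡m (k![n∸k]!∣n! (m≤m+n j s)) ⟩
  (j + s) !
    ∎
  where instance _ = j !* (j + s ∸ j) !≢0

binomial*factorial≡rising : ∀ s j → ((j + s) C j) * j ! ≡ rising s j
binomial*factorial≡rising s j = *-cancelʳ-≡ _ _ (s !) {{s !≢0}} (begin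
  ((j + s) C j) * j ! * s !      ≡⟨ *-assoc ((j + s) C j) (j !) (s !) ⟩
  ((j + s) C j) * (j ! * s !)    ≡⟨ binomial*factorials s j ⟩
  (j + s) !                      ≡⟨ [j+s]!≡rising*s! s j ⟩
  rising s j * s !               ∎)

prime∣rising⇒≤ : ∀ {p s} j → Prime p → p ∣ s → p ∣ rising s j → p ≤ j
prime∣rising⇒≤ zero p-prime _ p∣1 =
  contradiction (subst Prime (∣1⇒≡1 p∣1) p-prime) ¬prime[1]
prime∣rising⇒≤ {p} {s} (suc j) p-prime p∣s p∣r
  with euclidsLemma (suc (j + s)) (rising s j) p-prime p∣r
... | inj₁ p∣1+j+s = ∣⇒≤ (∣m+n∣m⇒∣n (subst (p ∣_) (+-comm (suc j) s) p∣1+j+s) p∣s)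
... | inj₂ p∣rᵢ   = m≤n⇒m≤1+n (prime∣rising⇒≤ j p-prime p∣s p∣rᵢ)

pdb⇒k∣binomial : (k σ : ℕ) → 1 ≤ k → σ > k * k ∸ k →
                 ∃ (λ (w : Str σ) → IsPdB k σ w) → k ∣ ((σ + k ∸ 1) C (k ∸ 1))
pdb⇒k∣binomial (suc m) σ _ σ>k²-k (w , pdb) =
  subst (λ n → suc m ∣ n C m) (cong (_∸ 1) (sym (+-suc σ m)))
        (pdb⇒∣binomial m w pdb (≤-<-trans (m+m≤[1+m]*[1+m]∸[1+m] m) σ>k²-k))

pdb⇒prime∤σ : (k σ : ℕ) → σ > k * k ∸ k → Prime k →
              ∃ (λ (w : Str σ) → IsPdB k σ w) → ¬ (k ∣ σ)
pdb⇒prime∤σ zero    σ _       k-prime _   = contradiction k-prime ¬prime[0]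
pdb⇒prime∤σ (suc m) σ σ>k²-k k-prime pdb k∣σ = 1+n≰n (prime∣rising⇒≤ m k-prime k∣σ k∣rising)
  where
  k∣binomial : suc m ∣ (m + σ) C m
  k∣binomial = subst (λ n → suc m ∣ n C m) (trans (cong (_∸ 1) (+-suc σ m)) (+-comm σ m))
                     (pdb⇒k∣binomial (suc m) σ (s≤s z≤n) σ>k²-k pdb)

  k∣rising : suc m ∣ rising σ m
  k∣rising = subst (suc m ∣_) (binomial*factorial≡rising σ m) (∣m⇒∣m*n (m !) k∣binomial)

corollary1 : ((k σ : ℕ) → 1 ≤ k → σ > k * k ∸ k →
                  ∃ (λ (w : Str σ) → IsPdB k σ w) → k ∣ ((σ + k ∸ 1) C (k ∸ 1)))
             × ((k σ : ℕ) → σ > k * k ∸ k → Prime k →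
                  ∃ (λ (w : Str σ) → IsPdB k σ w) → ¬ (k ∣ σ))
corollary1 = pdb⇒k∣binomial , pdb⇒prime∤σ
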